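{- Let $E$ be a finite set and $\mathcal{L}$ a set of subsets of $E$ such that the toggle group $T(\mathcal{L})$ acts transitively on $\mathcal{L}$, $|\mathcal{L}|$ is a prime power, and $T(\mathcal{L})$ contains a cycle of length $|\mathcal{L}|$. Then $T(\mathcal{L})$ is primitive.
   Context: For $e\in E$, the toggle $\tau_e:\mathcal{L}\to\mathcal{L}$ is defined by $\tau_e(X)=X\triangle\{e\}$ if $X\triangle\{e\}\in\mathcal{L}$, and $\tau_e(X)=X$ otherwise; the toggle group $T(\mathcal{L})$ is the subgroup of the symmetric group on $\mathcal{L}$ generated by $\{\tau_e: e\in E\}$, and its degree is $|\mathcal{L}|$. A transitive action is primitive if there is no block system with block size strictly between $1$ and $|\mathcal{L}|$ (a block being a subset $\mathcal{B}$ with $g(\mathcal{B})=\mathcal{B}$ or $g(\mathcal{B})\cap\mathcal{B}=\emptyset$ for all group elements $g$). -}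

module Defs where

open import Data.Nat using (ℕ; suc; _<_; _^_)
open import Data.Nat.Primality using (Prime)
open import Data.Bool using (Bool; not) renaming (_≟_ to _≟ᴮ_)
open import Data.Fin using (Fin; toℕ)
open import Data.Fin.Subset using (Subset; _∈_; ∣_∣)
open import Data.Vec using (Vec; _[_]%=_)
open import Data.Vec.Properties using (≡-dec)
open import Data.List using (List; length; foldr; lookup)
open import Data.Sum using (_⊎_)
open import Data.List.Relation.Unary.Any using (index)
open import Data.List.Relation.Unary.Unique.Propositional using (Unique)
import Data.List.Membership.DecPropositional as DecMem
open import Data.Product using (Σ; ∃; ∃-syntax; _×_; _,_)
open import Relation.Nullary using (¬_; yes; no)
open import Relation.Binary.PropositionalEquality using (_≡_; _≢_)
open import Function using (id; _∘_)

-- The ground set E is Fin n; subsets of E are characteristic vectors.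
-- X △ {e}
flip : ∀ {n} → Subset n → Fin n → Subset n
flip X e = X [ e ]%= not

private
  module M {n : ℕ} = DecMem (≡-dec {n = n} _≟ᴮ_)

-- A family 𝓛 of subsets of E, given as a duplicate-free list; its elements
-- are identified with their positions Fin (length 𝓛), so |𝓛| = length 𝓛.
record Family (n : ℕ) : Set where
  constructor family
  field
    sets   : List (Subset n)
    unique : Unique sets

open Family public

deg : ∀ {n} → Family n → ℕ
deg 𝓛 = length (sets 𝓛)

elt : ∀ {n} (𝓛 : Family n) → Fin (deg 𝓛) → Subset n
elt 𝓛 i = lookup (sets 𝓛) i

toggle : ∀ {n} (𝓛 : Family n) → Fin n → Fin (deg 𝓛) → Fin (deg 𝓛)
toggle 𝓛 e i with M._∈?_ (flip (elt 𝓛 i) e) (sets 𝓛)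
... | yes p = index p
... | no  _ = i

-- Elements of the toggle group T(𝓛) are represented by words in the
-- toggles (the toggles are involutions, so words give the whole generated
-- group); a word acts by composition (rightmost letter applied first).
act : ∀ {n} (𝓛 : Family n) → List (Fin n) → Fin (deg 𝓛) → Fin (deg 𝓛)
act 𝓛 w = foldr (λ e f → toggle 𝓛 e ∘ f) id w

Transitive : ∀ {n} → Family n → Set
Transitive 𝓛 = ∀ (x y : Fin (deg 𝓛)) → ∃[ w ] act 𝓛 w x ≡ y

IsPrimePower : ℕ → Set
IsPrimePower m = ∃[ p ] ∃[ k ] (Prime p × m ≡ p ^ suc k)

iterate : ∀ {A : Set} → (A → A) → ℕ → A → A
iterate f 0 x = x
iterate f (suc k) x = f (iterate f k x)

IsFullCycle : ∀ {N} → (Fin N → Fin N) → Set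
IsFullCycle {N} f =
  ∃[ x ] ((∀ (i j : Fin N) → i ≢ j → iterate f (toℕ i) x ≢ iterate f (toℕ j) x)
          × iterate f N x ≡ x)

ContainsFullCycle : ∀ {n} → Family n → Set
ContainsFullCycle 𝓛 = ∃[ w ] IsFullCycle (act 𝓛 w)

IsBlock : ∀ {n} (𝓛 : Family n) → Subset (deg 𝓛) → Set
IsBlock 𝓛 B = ∀ (w : List _) →
    (∀ y → (y ∈ B → ∃[ x ] (x ∈ B × act 𝓛 w x ≡ y))
         × (∃[ x ] (x ∈ B × act 𝓛 w x ≡ y) → y ∈ B))
  ⊎ (∀ x → x ∈ B → ¬ (act 𝓛 w x ∈ B))

Primitive : ∀ {n} → Family n → Set
Primitive 𝓛 = Transitive 𝓛 ×
  (∀ (B : Subset (deg 𝓛)) → IsBlock 𝓛 B → ¬ (1 < ∣ B ∣ × ∣ B ∣ < deg 𝓛))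

{-# OPTIONS --safe #-}
module Submission where

-- A block system is the same thing as an equivalence ≈ on 𝓛 preserved by
-- every toggle. Call a letter e internal if τ_e moves some point inside its
-- ≈-class; by transitivity it then keeps every point in its class, while an
-- external τ_f never does. Internal and external toggles commute, so the
-- N-cycle c splits as c = cᴵ cˣ with commuting factors acting as rotations of
-- the orbit x_j = cʲ x₀. The indices j with x_j ≈ x₀ are the multiples of a
-- proper divisor r of N = p^(k+1), hence p ∣ r ∣ T = p^k; cᴵ rotates by a
-- multiple of r, so c^T x₀ = (cˣ)^T x₀. External toggles translate a whole
-- class by one bit vector, so (cˣ)^r shifts the class of x₀ by a vector D and
-- c^T x₀ = x₀ + (T/r)·D. As c^T x₀ ≠ x₀, T/r is odd and D ≠ 0, while
-- (cˣ)^N x₀ = x₀ makes N/r even: p = 2, T = r and the classes are {z, z + D}.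
-- Then for a coordinate s with D_s = 1, σ = c^r and τ_s generate a Klein
-- group acting freely on the points moved by τ_s, so the number of moves of
-- s along any word, summed over all starting points, is divisible by 4; along
-- the cycle it is twice the odd number of flips of s between x₀ and x_r.

open import Defs
open import Data.Nat as ℕ
  using (ℕ; zero; suc; _+_; _*_; _^_; _/_; _%_; _<_; _>_; _≤_; z≤n; s≤s; z<s; NonZero; nonTrivial⇒n>1)
open import Data.Nat.Properties
  using ( +-comm; +-assoc; +-identityʳ; *-comm; *-assoc; *-distribˡ-+; *-cancelʳ-≡
        ; ≤-refl; ≤-trans; ≤-<-trans; <-irrefl; <-asym; <-cmp; ≤∧≢⇒<; m≤n⇒m≤1+n; m<1+n⇒m<n∨m≡n
        ; +-monoʳ-≤; m≤m+n; m<m*n; m^n≢0; +-0-commutativeMonoid )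
open import Data.Nat.Divisibility
  using ( _∣_; divides; _∣?_; ∣1⇒≡1; *-cancelˡ-∣; *-monoʳ-∣; ∣m∣n⇒∣m+n; ∣-refl; _∣0; 1∣_; ∣⇒≤
        ; m%n≡0⇒n∣m )
open import Data.Nat.DivMod using (m≡m%n+[m/n]*n; m%n<n)
open import Data.Nat.Coprimality using (Coprime; coprime-divisor)
open import Data.Nat.Primality using (Prime; prime⇒irreducible; prime⇒nonZero; prime⇒nonTrivial)
open import Data.Bool using (Bool; true; false; not; _xor_; _∧_; if_then_else_) renaming (_≟_ to _≟ᴮ_)
open import Data.Bool.Properties
  using ( ∧-zeroʳ; ∧-identityʳ; ¬-not; not-involutive; not-distribˡ-xor
        ; xor-same; xor-identityʳ; xor-assoc; xor-comm; xor-inverseʳ )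
open import Data.Fin as Fin using (Fin; zero; suc; toℕ; punchOut; fromℕ<)
open import Data.Fin.Properties
  using (any?; punchOut-injective; injective⇒≤; toℕ-injective; suc-injective; toℕ<n; toℕ-fromℕ<)
open import Data.Fin.Subset using (Subset; _∈_; _∉_; ∣_∣)
open import Data.Fin.Subset.Properties using (_∈?_)
open import Data.Fin.Permutation using (permutation)
open import Data.Vec using (_∷_; []; here; there; lookup)
open import Data.Vec.Properties
  using (≡-dec; updateAt-updateAt; updateAt-id-local; updateAt-commutes; lookup∘updateAt; lookup∘updateAt′)
open import Data.List as List using (List; _∷_; []; _++_; [_]; concat; replicate; reverse; filter)
open import Data.List.Properties using (unfold-reverse)
open import Data.List.Relation.Unary.All as All using (All; _∷_; [])
import Data.List.Relation.Unary.All.Properties as Allₚ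
open import Data.List.Relation.Unary.AllPairs using (_∷_)
open import Data.List.Relation.Unary.Unique.Propositional using (Unique)
open import Data.List.Relation.Unary.Any.Properties using (lookup-index)
open import Data.List.Membership.Propositional using () renaming (_∈_ to _∈ˡ_)
open import Data.List.Membership.Propositional.Properties using (∈-lookup)
import Data.List.Membership.DecPropositional as DecMem
open import Data.Vec.Relation.Binary.Pointwise.Extensional using (ext; Pointwise-≡⇒≡)
open import Data.Product using (∃; ∃-syntax; _×_; _,_; proj₁; proj₂)
open import Data.Sum using (_⊎_; inj₁; inj₂)
open import Data.Empty using (⊥; ⊥-elim)
open import Relation.Nullary using (¬_; Dec; yes; no; does)
open import Relation.Nullary.Decidable using (¬?; _×-dec_)
open import Relation.Unary using (Pred; Decidable)
open import Relation.Binary.Definitions using (tri<; tri≈; tri>)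
open import Relation.Binary.PropositionalEquality hiding ([_])
open import Function using (_∘_; _⇔_; mk⇔; Equivalence)
open import Function.Definitions using (Injective)
import Algebra.Properties.CommutativeMonoid.Sum as CommutativeMonoidSum

open CommutativeMonoidSum +-0-commutativeMonoid
  using (sum; sum-permute; ∑-distrib-+; sum-cong-≗; sum-replicate-zero)

true≢false : true ≢ false
true≢false ()

xor-cancel-middle : ∀ a b c → (a xor b) xor (b xor c) ≡ a xor c
xor-cancel-middle a b c = begin
  (a xor b) xor (b xor c) ≡⟨ xor-assoc a b (b xor c) ⟩
  a xor (b xor (b xor c)) ≡⟨ cong (a xor_) (sym (xor-assoc b b c)) ⟩
  a xor ((b xor b) xor c) ≡⟨ cong (λ d → a xor (d xor c)) (xor-same b) ⟩
  a xor c                 ∎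
  where open ≡-Reasoning

xor-∧ : ∀ a b → b xor (a ∧ b) ≡ not a ∧ b
xor-∧ true  b = xor-same b
xor-∧ false b = xor-identityʳ b

xor-swap-middle : ∀ a b c d → a xor b ≡ c xor d → a xor c ≡ b xor d
xor-swap-middle a b c d eq = begin
  a xor c                 ≡⟨ xor-cancel-middle a b c ⟨
  (a xor b) xor (b xor c) ≡⟨ cong (_xor (b xor c)) eq ⟩
  (c xor d) xor (b xor c) ≡⟨ cong₂ _xor_ (xor-comm c d) (xor-comm b c) ⟩
  (d xor c) xor (c xor b) ≡⟨ xor-cancel-middle d c b ⟩
  d xor b                 ≡⟨ xor-comm d b ⟩
  b xor d                 ∎
  where open ≡-Reasoning

xor≡false⇒≡ : ∀ {a b} → a xor b ≡ false → a ≡ b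
xor≡false⇒≡ {false} {false} _ = refl
xor≡false⇒≡ {true}  {true}  _ = refl

xor≡true⇒≡not : ∀ {a b} → a xor b ≡ true → a ≡ not b
xor≡true⇒≡not {false} {true}  _ = refl
xor≡true⇒≡not {true}  {false} _ = refl

xor-cancelʳ : ∀ a b c → a xor c ≡ b xor c → a ≡ b
xor-cancelʳ a b c eq = xor≡false⇒≡ (trans (xor-swap-middle a c b c eq) (xor-same c))

isOdd : ℕ → Bool
isOdd zero    = false
isOdd (suc n) = not (isOdd n)

isOdd-+ : ∀ m n → isOdd (m + n) ≡ isOdd m xor isOdd n
isOdd-+ zero    n = refl
isOdd-+ (suc m) n = trans (cong not (isOdd-+ m n)) (not-distribˡ-xor (isOdd m) (isOdd n))

isOdd-* : ∀ m n → isOdd (m * n) ≡ isOdd m ∧ isOdd n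
isOdd-* zero    n = refl
isOdd-* (suc m) n = trans (isOdd-+ n (m * n)) (trans (cong (isOdd n xor_) (isOdd-* m n)) (xor-∧ (isOdd m) (isOdd n)))

isOdd≡false⇒2∣ : ∀ n → isOdd n ≡ false → 2 ∣ n
isOdd≡false⇒2∣ zero          _    = 2 ∣0
isOdd≡false⇒2∣ (suc (suc n)) even =
  ∣m∣n⇒∣m+n ∣-refl (isOdd≡false⇒2∣ n (trans (sym (not-involutive (isOdd n))) even))

n+n≡n*2 : ∀ n → n + n ≡ n * 2
n+n≡n*2 n = trans (cong (n +_) (sym (+-identityʳ n))) (*-comm 2 n)

isOdd≡true⇒¬4∣n+n : ∀ m → isOdd m ≡ true → ¬ 4 ∣ m + m
isOdd≡true⇒¬4∣n+n m m-odd (divides q m+m≡q*4) = true≢false (begin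
  true              ≡⟨ m-odd ⟨
  isOdd m           ≡⟨ cong isOdd m≡q*2 ⟩
  isOdd (q * 2)     ≡⟨ isOdd-* q 2 ⟩
  isOdd q ∧ false   ≡⟨ ∧-zeroʳ (isOdd q) ⟩
  false             ∎)
  where
  open ≡-Reasoning
  m≡q*2 : m ≡ q * 2
  m≡q*2 = *-cancelʳ-≡ m (q * 2) 2 (trans (sym (n+n≡n*2 m)) (trans m+m≡q*4 (sym (*-assoc q 2 2))))

∧≡true : ∀ {a b} → a ∧ b ≡ true → a ≡ true × b ≡ true
∧≡true {true} {true} _ = refl , refl

∤⇒coprime : ∀ {p d} → Prime p → ¬ p ∣ d → Coprime d p
∤⇒coprime p-prime p∤d (k∣d , k∣p) with prime⇒irreducible p-prime k∣p
... | inj₁ k≡1 = k≡1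
... | inj₂ refl = ⊥-elim (p∤d k∣d)

∣p^k⇒≡p^j : ∀ {p} → Prime p → ∀ k {d} → d ∣ p ^ k → ∃[ j ] (j ≤ k × d ≡ p ^ j)
∣p^k⇒≡p^j p-prime zero d∣1 = 0 , z≤n , ∣1⇒≡1 d∣1
∣p^k⇒≡p^j {p} p-prime (suc k) {d} d∣p^k+1 with p ∣? d
... | no p∤d =
  let j , j≤k , d≡p^j = ∣p^k⇒≡p^j p-prime k (coprime-divisor (∤⇒coprime p-prime p∤d) d∣p^k+1)
  in  j , m≤n⇒m≤1+n j≤k , d≡p^j
... | yes (divides q refl) =
  let j , j≤k , q≡p^j = ∣p^k⇒≡p^j p-prime k
                          (*-cancelˡ-∣ p {{prime⇒nonZero p-prime}} (subst (_∣ p ^ suc k) (*-comm q p) d∣p^k+1))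
  in  suc j , s≤s j≤k , trans (*-comm q p) (cong (p *_) q≡p^j)

p^j∣p^k : ∀ p {j k} → j ≤ k → p ^ j ∣ p ^ k
p^j∣p^k p z≤n       = 1∣ _
p^j∣p^k p (s≤s j≤k) = *-monoʳ-∣ p (p^j∣p^k p j≤k)

proper-∣p^[1+k] : ∀ {p} → Prime p → ∀ k {d} → d ∣ p ^ suc k → d ≢ 1 → d ≢ p ^ suc k → (p ∣ d) × (d ∣ p ^ k)
proper-∣p^[1+k] {p} p-prime k d∣p^[1+k] d≢1 d≢p^[1+k] with ∣p^k⇒≡p^j p-prime (suc k) d∣p^[1+k]
... | zero  , _         , d≡1  = ⊥-elim (d≢1 d≡1)
... | suc i , s≤s i≤k   , refl =
  divides (p ^ i) (*-comm p (p ^ i)) , p^j∣p^k p (≤∧≢⇒< i≤k (d≢p^[1+k] ∘ cong (λ j → p ^ suc j)))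

minimal-witness-below : ∀ {ℓ} {P : Pred ℕ ℓ} → Decidable P →
  ∀ m → ∃[ r ] (P r × (∀ k → k < r → ¬ P k)) ⊎ (∀ k → k < m → ¬ P k)
minimal-witness-below P? zero = inj₂ (λ _ ())
minimal-witness-below {P = P} P? (suc m) with minimal-witness-below P? m | P? m
... | inj₁ found | _      = inj₁ found
... | inj₂ none  | yes pm = inj₁ (m , pm , none)
... | inj₂ none  | no ¬pm = inj₂ λ k k<1+m → below-or-at (m<1+n⇒m<n∨m≡n k<1+m)
  where
  below-or-at : ∀ {k} → k < m ⊎ k ≡ m → ¬ P k
  below-or-at (inj₁ k<m)  = none _ k<m
  below-or-at (inj₂ refl) = ¬pm

minimal-witness : ∀ {ℓ} {P : Pred ℕ ℓ} → Decidable P → ∀ m → P m → ∃[ r ] (P r × (∀ k → k < r → ¬ P k))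
minimal-witness P? m pm with minimal-witness-below P? (suc m)
... | inj₁ found = found
... | inj₂ none  = ⊥-elim (none m ≤-refl pm)

nonempty-member : ∀ {m} (P : Subset m) → 0 < ∣ P ∣ → ∃ (_∈ P)
nonempty-member (true  ∷ P) _ = zero , here
nonempty-member (false ∷ P) 0<∣P∣ = let a , a∈P = nonempty-member P 0<∣P∣ in suc a , there a∈P

two-members : ∀ {m} (P : Subset m) → 1 < ∣ P ∣ → ∃[ a ] ∃[ b ] (a ∈ P × b ∈ P × a ≢ b)
two-members (true ∷ P) (s≤s 0<∣P∣) =
  let a , a∈P = nonempty-member P 0<∣P∣ in zero , suc a , here , there a∈P , λ ()
two-members (false ∷ P) 1<∣P∣ =
  let a , b , a∈P , b∈P , a≢b = two-members P 1<∣P∣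
  in  suc a , suc b , there a∈P , there b∈P , a≢b ∘ suc-injective

non-member : ∀ {m} (P : Subset m) → ∣ P ∣ < m → ∃ (_∉ P)
non-member (true ∷ P) (s≤s ∣P∣<m) =
  let a , a∉P = non-member P ∣P∣<m in suc a , λ { (there a∈P) → a∉P a∈P }
non-member (false ∷ P) _ = zero , λ ()

injective⇒surjective : ∀ {m} (f : Fin m → Fin m) → Injective _≡_ _≡_ f → ∀ y → ∃ λ j → f j ≡ y
injective⇒surjective {suc m} f f-inj y with any? (λ j → f j Fin.≟ y)
... | yes hit = hit
... | no  miss = ⊥-elim (<-irrefl refl (injective⇒≤ g-inj))
  where
  y≢f : ∀ j → y ≢ f j
  y≢f j y≡fj = miss (j , sym y≡fj)
  g : Fin (suc m) → Fin m
  g j = punchOut (y≢f j)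
  g-inj : Injective _≡_ _≡_ g
  g-inj = f-inj ∘ punchOut-injective (y≢f _) (y≢f _)

iterate-+ : ∀ {A : Set} (f : A → A) m n x → iterate f (m + n) x ≡ iterate f m (iterate f n x)
iterate-+ f zero    n x = refl
iterate-+ f (suc m) n x = cong f (iterate-+ f m n x)

iterate-commute : ∀ {A : Set} (f g : A → A) → (∀ x → g (f x) ≡ f (g x)) →
                  ∀ j x → g (iterate f j x) ≡ iterate f j (g x)
iterate-commute f g gf≡fg zero    x = refl
iterate-commute f g gf≡fg (suc j) x = trans (gf≡fg _) (cong f (iterate-commute f g gf≡fg j x))

iterate-cong : ∀ {A : Set} {f g : A → A} → (∀ x → f x ≡ g x) → ∀ j x → iterate f j x ≡ iterate g j x
iterate-cong f≗g zero    x = refl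
iterate-cong {g = g} f≗g (suc j) x = trans (f≗g _) (cong g (iterate-cong f≗g j x))

sum-∘-bijection : ∀ {m} (π π⁻¹ : Fin m → Fin m) → (∀ y → π⁻¹ (π y) ≡ y) → (∀ y → π (π⁻¹ y) ≡ y) →
                  ∀ h → sum (h ∘ π) ≡ sum h
sum-∘-bijection π π⁻¹ left right h = sym (sum-permute h (permutation π π⁻¹ right left))

sum-involution-invariant-even : ∀ {m} (ρ : Fin m → Fin m) → (∀ z → ρ (ρ z) ≡ z) →
  ∀ f → (∀ z → f (ρ z) ≡ f z) → (∀ z → ρ z ≡ z → f z ≡ 0) → 2 ∣ sum f
sum-involution-invariant-even ρ ρρ f fρ fixed =
  divides (sum ascending) (trans (sum-cong-≗ split) (trans (∑-distrib-+ ascending (ascending ∘ ρ))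
    (trans (cong (sum ascending +_) (sum-∘-bijection ρ ρ ρρ ρρ ascending)) (n+n≡n*2 (sum ascending)))))
  where
  ascending : _ → ℕ
  ascending z with z Fin.<? ρ z
  ... | yes _ = f z
  ... | no  _ = 0
  ρρ-< : ∀ {z} → ρ z Fin.< ρ (ρ z) → ρ z Fin.< z
  ρρ-< {z} = subst (ρ z Fin.<_) (ρρ z)
  trichotomy-fixed : ∀ {z} → ¬ z Fin.< ρ z → ¬ ρ z Fin.< z → ρ z ≡ z
  trichotomy-fixed {z} z≮ρz ρz≮z with <-cmp (toℕ z) (toℕ (ρ z))
  ... | tri< z<ρz _ _ = ⊥-elim (z≮ρz z<ρz)
  ... | tri≈ _ z≡ρz _ = sym (toℕ-injective z≡ρz)
  ... | tri> _ _ ρz<z = ⊥-elim (ρz≮z ρz<z)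
  split : ∀ z → f z ≡ ascending z + ascending (ρ z)
  split z with z Fin.<? ρ z | ρ z Fin.<? ρ (ρ z)
  ... | yes _    | no _      = sym (+-identityʳ (f z))
  ... | no _     | yes _     = sym (fρ z)
  ... | yes z<ρz | yes ρz<ρρz = ⊥-elim (<-asym z<ρz (ρρ-< ρz<ρρz))
  ... | no z≮ρz  | no ρz≮ρρz = fixed z (trichotomy-fixed z≮ρz (ρz≮ρρz ∘ subst (ρ z Fin.<_) (sym (ρρ z))))

sumBelow : ℕ → (ℕ → ℕ) → ℕ
sumBelow zero    h = 0
sumBelow (suc m) h = h 0 + sumBelow m (h ∘ suc)

sum≡sumBelow : ∀ m (h : ℕ → ℕ) → sum {m} (h ∘ toℕ) ≡ sumBelow m h
sum≡sumBelow zero    h = refl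
sum≡sumBelow (suc m) h = cong (h 0 +_) (sum≡sumBelow m (h ∘ suc))

sumBelow-+ : ∀ a b (h : ℕ → ℕ) → sumBelow (a + b) h ≡ sumBelow a h + sumBelow b (λ j → h (a + j))
sumBelow-+ zero    b h = refl
sumBelow-+ (suc a) b h = trans (cong (h 0 +_) (sumBelow-+ a b (h ∘ suc))) (sym (+-assoc (h 0) _ _))

sumBelow-cong : ∀ m {h h′ : ℕ → ℕ} → (∀ j → h j ≡ h′ j) → sumBelow m h ≡ sumBelow m h′
sumBelow-cong zero    h≗h′ = refl
sumBelow-cong (suc m) h≗h′ = cong₂ _+_ (h≗h′ 0) (sumBelow-cong m (h≗h′ ∘ suc))

isOdd-sumBelow-telescope : ∀ m (h : ℕ → ℕ) (β : ℕ → Bool) → (∀ j → isOdd (h j) ≡ β j xor β (suc j)) →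
                           isOdd (sumBelow m h) ≡ β 0 xor β m
isOdd-sumBelow-telescope zero    h β step = sym (xor-same (β 0))
isOdd-sumBelow-telescope (suc m) h β step = begin
  isOdd (h 0 + sumBelow m (h ∘ suc))        ≡⟨ isOdd-+ (h 0) _ ⟩
  isOdd (h 0) xor isOdd (sumBelow m (h ∘ suc)) ≡⟨ cong₂ _xor_ (step 0) (isOdd-sumBelow-telescope m (h ∘ suc) (β ∘ suc) (step ∘ suc)) ⟩
  (β 0 xor β 1) xor (β 1 xor β (suc m))    ≡⟨ xor-cancel-middle (β 0) (β 1) (β (suc m)) ⟩
  β 0 xor β (suc m)                         ∎
  where open ≡-Reasoning

flip-involutive : ∀ {n} (X : Subset n) e → flip (flip X e) e ≡ X
flip-involutive X e = trans (updateAt-updateAt e X) (updateAt-id-local e X (not-involutive _))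

flip-comm : ∀ {n} (X : Subset n) e f → flip (flip X e) f ≡ flip (flip X f) e
flip-comm X e f with e Fin.≟ f
... | yes refl = refl
... | no  e≢f  = updateAt-commutes f e (e≢f ∘ sym) X

lookup-flip : ∀ {n} (X : Subset n) e → lookup (flip X e) e ≡ not (lookup X e)
lookup-flip X e = lookup∘updateAt e X

lookup-flip-≢ : ∀ {n} (X : Subset n) {e} k → k ≢ e → lookup (flip X e) k ≡ lookup X k
lookup-flip-≢ X {e} k k≢e = lookup∘updateAt′ k e k≢e X

lookup-injective : ∀ {A : Set} {xs : List A} → Unique xs → Injective _≡_ _≡_ (List.lookup xs)
lookup-injective {xs = _ ∷ _} (_ ∷ _)   {zero}  {zero}  _  = refl
lookup-injective {xs = _ ∷ _} (x∉ ∷ _)  {zero}  {suc j} eq = ⊥-elim (All.lookup x∉ (∈-lookup j) eq)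
lookup-injective {xs = _ ∷ _} (x∉ ∷ _)  {suc i} {zero}  eq = ⊥-elim (All.lookup x∉ (∈-lookup i) (sym eq))
lookup-injective {xs = _ ∷ _} (_ ∷ xs!) {suc i} {suc j} eq = cong suc (lookup-injective xs! eq)

power : ∀ {A : Set} → List A → ℕ → List A
power w j = concat (replicate j w)

All-power : ∀ {A : Set} {ℓ} {P : Pred A ℓ} {w} → All P w → ∀ j → All P (power w j)
All-power pw j = Allₚ.concat⁺ (Allₚ.replicate⁺ j pw)

module Toggles {n : ℕ} (𝓛 : Family n) where

  Point : Set
  Point = Fin (deg 𝓛)

  τ : Fin n → Point → Point
  τ = toggle 𝓛

  bit : Point → Fin n → Bool
  bit y = lookup (elt 𝓛 y)

  elt-injective : Injective _≡_ _≡_ (elt 𝓛)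
  elt-injective = lookup-injective (unique 𝓛)

  ≡-from-bits : ∀ {y z} → (∀ k → bit y k ≡ bit z k) → y ≡ z
  ≡-from-bits y≗z = elt-injective (Pointwise-≡⇒≡ (ext y≗z))

  toggle-cases : ∀ e y → (τ e y ≡ y × (∀ z → elt 𝓛 z ≢ flip (elt 𝓛 y) e))
                       ⊎ elt 𝓛 (τ e y) ≡ flip (elt 𝓛 y) e
  toggle-cases e y with DecMem._∈?_ (≡-dec _≟ᴮ_) (flip (elt 𝓛 y) e) (sets 𝓛)
  ... | yes flip∈ = inj₂ (sym (lookup-index flip∈))
  ... | no  flip∉ = inj₁ (refl , λ z eq → flip∉ (subst (_∈ˡ sets 𝓛) eq (∈-lookup z)))

  elt-toggle : ∀ e y → τ e y ≢ y → elt 𝓛 (τ e y) ≡ flip (elt 𝓛 y) e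
  elt-toggle e y moved with toggle-cases e y
  ... | inj₁ (fixed , _) = ⊥-elim (moved fixed)
  ... | inj₂ eq          = eq

  toggle-to : ∀ e y z → elt 𝓛 z ≡ flip (elt 𝓛 y) e → τ e y ≡ z
  toggle-to e y z eq with toggle-cases e y
  ... | inj₁ (_ , absent) = ⊥-elim (absent z eq)
  ... | inj₂ eq′          = elt-injective (trans eq′ (sym eq))

  toggle-involutive : ∀ e y → τ e (τ e y) ≡ y
  toggle-involutive e y with toggle-cases e y
  ... | inj₁ (fixed , _) = trans (cong (τ e) fixed) fixed
  ... | inj₂ eq = toggle-to e (τ e y) y (sym (trans (cong (λ X → flip X e) eq) (flip-involutive _ e)))

  bit-toggle : ∀ e y → τ e y ≢ y → bit (τ e y) e ≡ not (bit y e)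
  bit-toggle e y moved = trans (cong (λ X → lookup X e) (elt-toggle e y moved)) (lookup-flip (elt 𝓛 y) e)

  bit-toggle-≢ : ∀ e y k → k ≢ e → bit (τ e y) k ≡ bit y k
  bit-toggle-≢ e y k k≢e with τ e y Fin.≟ y
  ... | yes fixed = cong (λ z → bit z k) fixed
  ... | no  moved = trans (cong (λ X → lookup X k) (elt-toggle e y moved)) (lookup-flip-≢ (elt 𝓛 y) k k≢e)

  act-++ : ∀ u v y → act 𝓛 (u ++ v) y ≡ act 𝓛 u (act 𝓛 v y)
  act-++ []      v y = refl
  act-++ (e ∷ u) v y = cong (τ e) (act-++ u v y)

  act-power : ∀ w j y → act 𝓛 (power w j) y ≡ iterate (act 𝓛 w) j y
  act-power w zero    y = refl
  act-power w (suc j) y = trans (act-++ w (power w j) y) (cong (act 𝓛 w) (act-power w j y))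

  act-reverse-inverseˡ : ∀ w y → act 𝓛 (reverse w) (act 𝓛 w y) ≡ y
  act-reverse-inverseˡ []      y = refl
  act-reverse-inverseˡ (e ∷ w) y = begin
    act 𝓛 (reverse (e ∷ w)) (τ e (act 𝓛 w y))      ≡⟨ cong (λ v → act 𝓛 v (τ e (act 𝓛 w y))) (unfold-reverse e w) ⟩
    act 𝓛 (reverse w ++ [ e ]) (τ e (act 𝓛 w y))  ≡⟨ act-++ (reverse w) [ e ] _ ⟩
    act 𝓛 (reverse w) (τ e (τ e (act 𝓛 w y)))     ≡⟨ cong (act 𝓛 (reverse w)) (toggle-involutive e _) ⟩
    act 𝓛 (reverse w) (act 𝓛 w y)                 ≡⟨ act-reverse-inverseˡ w y ⟩
    y                                              ∎
    where open ≡-Reasoning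

  act-reverse-inverseʳ : ∀ w y → act 𝓛 w (act 𝓛 (reverse w) y) ≡ y
  act-reverse-inverseʳ []      y = refl
  act-reverse-inverseʳ (e ∷ w) y = begin
    τ e (act 𝓛 w (act 𝓛 (reverse (e ∷ w)) y))     ≡⟨ cong (λ v → τ e (act 𝓛 w (act 𝓛 v y))) (unfold-reverse e w) ⟩
    τ e (act 𝓛 w (act 𝓛 (reverse w ++ [ e ]) y)) ≡⟨ cong (τ e ∘ act 𝓛 w) (act-++ (reverse w) [ e ] y) ⟩
    τ e (act 𝓛 w (act 𝓛 (reverse w) (τ e y)))    ≡⟨ cong (τ e) (act-reverse-inverseʳ w (τ e y)) ⟩
    τ e (τ e y)                                   ≡⟨ toggle-involutive e y ⟩
    y                                             ∎
    where open ≡-Reasoning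

  toggle-injective : ∀ e {y z} → τ e y ≡ τ e z → y ≡ z
  toggle-injective e {y} {z} eq = trans (sym (toggle-involutive e y)) (trans (cong (τ e) eq) (toggle-involutive e z))

  toggle-square : ∀ e f y → τ e y ≢ y → τ f y ≢ y → τ f (τ e y) ≢ τ e y → τ e (τ f y) ≡ τ f (τ e y)
  toggle-square e f y e-moves f-moves f-moves′ = toggle-to e (τ f y) (τ f (τ e y)) (begin
    elt 𝓛 (τ f (τ e y))      ≡⟨ elt-toggle f (τ e y) f-moves′ ⟩
    flip (elt 𝓛 (τ e y)) f   ≡⟨ cong (λ X → flip X f) (elt-toggle e y e-moves) ⟩
    flip (flip (elt 𝓛 y) e) f ≡⟨ flip-comm (elt 𝓛 y) e f ⟩
    flip (flip (elt 𝓛 y) f) e ≡⟨ cong (λ X → flip X e) (elt-toggle f y f-moves) ⟨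
    flip (elt 𝓛 (τ f y)) e   ∎)
    where open ≡-Reasoning

  bit-act-untouched : ∀ {k} u → All (_≢ k) u → ∀ y → bit (act 𝓛 u y) k ≡ bit y k
  bit-act-untouched []      []            y = refl
  bit-act-untouched (e ∷ u) (e≢k ∷ u≢k) y =
    trans (bit-toggle-≢ e (act 𝓛 u y) _ (e≢k ∘ sym)) (bit-act-untouched u u≢k y)

  Δ : Point → Point → Fin n → Bool
  Δ y z k = bit y k xor bit z k

  Δ-toggle-moved : ∀ f {a b y z} k → τ f a ≢ a → τ f b ≢ b → Δ a y k ≡ Δ b z k → Δ (τ f a) y k ≡ Δ (τ f b) z k
  Δ-toggle-moved f {a} {b} {y} {z} k a-moved b-moved eq with k Fin.≟ f
  ... | yes refl = begin
    bit (τ k a) k xor bit y k  ≡⟨ cong (_xor bit y k) (bit-toggle k a a-moved) ⟩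
    not (bit a k) xor bit y k  ≡⟨ not-distribˡ-xor (bit a k) (bit y k) ⟨
    not (Δ a y k)              ≡⟨ cong not eq ⟩
    not (Δ b z k)              ≡⟨ not-distribˡ-xor (bit b k) (bit z k) ⟩
    not (bit b k) xor bit z k  ≡⟨ cong (_xor bit z k) (bit-toggle k b b-moved) ⟨
    bit (τ k b) k xor bit z k  ∎
    where open ≡-Reasoning
  ... | no  k≢f  = trans (cong (_xor bit y k) (bit-toggle-≢ f a k k≢f))
                    (trans eq (cong (_xor bit z k) (sym (bit-toggle-≢ f b k k≢f))))

module FullCycle {N : ℕ} (c : Fin N → Fin N) (x₀ : Fin N)
  (distinct : ∀ (i j : Fin N) → i ≢ j → iterate c (toℕ i) x₀ ≢ iterate c (toℕ j) x₀)
  (returns : iterate c N x₀ ≡ x₀) where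

  x : ℕ → Fin N
  x j = iterate c j x₀

  x-+ : ∀ a b → x (a + b) ≡ iterate c a (x b)
  x-+ a b = iterate-+ c a b x₀

  x-+N : ∀ a → x (a + N) ≡ x a
  x-+N a = trans (x-+ a N) (cong (iterate c a) returns)

  x-periodic : ∀ q j → x (j + q * N) ≡ x j
  x-periodic zero    j = cong x (+-identityʳ j)
  x-periodic (suc q) j = begin
    x (j + (N + q * N)) ≡⟨ cong x (trans (cong (j +_) (+-comm N (q * N))) (sym (+-assoc j (q * N) N))) ⟩
    x (j + q * N + N)   ≡⟨ x-+N (j + q * N) ⟩
    x (j + q * N)       ≡⟨ x-periodic q j ⟩
    x j                 ∎
    where open ≡-Reasoning

  x-injective : Injective _≡_ _≡_ (x ∘ toℕ)
  x-injective {i} {j} eq with i Fin.≟ j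
  ... | yes i≡j = i≡j
  ... | no  i≢j = ⊥-elim (distinct i j i≢j eq)

  orbit-surjective : ∀ y → ∃ λ (j : Fin N) → x (toℕ j) ≡ y
  orbit-surjective = injective⇒surjective (x ∘ toℕ) x-injective

  sum≡sum-along-orbit : ∀ h → sum h ≡ sumBelow N (h ∘ x)
  sum≡sum-along-orbit h = trans (sym (sum-∘-bijection (x ∘ toℕ) (proj₁ ∘ orbit-surjective)
    (λ j → x-injective (proj₂ (orbit-surjective (x (toℕ j))))) (proj₂ ∘ orbit-surjective) h)) (sum≡sumBelow N (h ∘ x))

  commuting⇒rotation : ∀ g → (∀ z → g (c z) ≡ c (g z)) → ∃ λ (a : Fin N) → ∀ j → g (x j) ≡ x (j + toℕ a)
  commuting⇒rotation g gc≡cg = a , λ j →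
    trans (iterate-commute c g gc≡cg j x₀) (trans (cong (iterate c j) (sym xa≡gx₀)) (sym (x-+ j (toℕ a))))
    where
    a = proj₁ (orbit-surjective (g x₀))
    xa≡gx₀ = proj₂ (orbit-surjective (g x₀))

  iterate-rotation : ∀ {g a} → (∀ j → g (x j) ≡ x (j + a)) → ∀ m i → iterate g m (x i) ≡ x (i + m * a)
  iterate-rotation         g-rot zero    i = cong x (sym (+-identityʳ i))
  iterate-rotation {g} {a} g-rot (suc m) i = begin
    g (iterate g m (x i)) ≡⟨ cong g (iterate-rotation g-rot m i) ⟩
    g (x (i + m * a))     ≡⟨ g-rot (i + m * a) ⟩
    x (i + m * a + a)     ≡⟨ cong x (trans (+-assoc i (m * a) a) (cong (i +_) (+-comm (m * a) a))) ⟩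
    x (i + (a + m * a))   ∎
    where open ≡-Reasoning

record Congruence {n} (𝓛 : Family n) : Set₁ where
  field
    _≈_    : Fin (deg 𝓛) → Fin (deg 𝓛) → Set
    _≈?_   : ∀ y z → Dec (y ≈ z)
    ≈-refl  : ∀ {y} → y ≈ y
    ≈-sym   : ∀ {y z} → y ≈ z → z ≈ y
    ≈-trans : ∀ {y z u} → y ≈ z → z ≈ u → y ≈ u
    ≈-cong  : ∀ w {y z} → y ≈ z → act 𝓛 w y ≈ act 𝓛 w z

module BlockCongruence {n} (𝓛 : Family n) (transitive : Transitive 𝓛)
                       (B : Subset (deg 𝓛)) (B-block : IsBlock 𝓛 B) {b₀} (b₀∈B : b₀ ∈ B) where
  open Toggles 𝓛

  to-b₀ : Point → List (Fin n)
  to-b₀ y = proj₁ (transitive y b₀)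

  act-to-b₀ : ∀ y → act 𝓛 (to-b₀ y) y ≡ b₀
  act-to-b₀ y = proj₂ (transitive y b₀)

  act-to-b₀∈B : ∀ y → act 𝓛 (to-b₀ y) y ∈ B
  act-to-b₀∈B y = subst (_∈ B) (sym (act-to-b₀ y)) b₀∈B

  block-stable : ∀ g {y} → y ∈ B → act 𝓛 g y ∈ B → ∀ {z} → z ∈ B → act 𝓛 g z ∈ B
  block-stable g y∈B gy∈B {z} z∈B with B-block g
  ... | inj₁ gB≡B    = proj₂ (gB≡B (act 𝓛 g z)) (z , z∈B , refl)
  ... | inj₂ gB∩B≡∅ = ⊥-elim (gB∩B≡∅ _ y∈B gy∈B)

  _≈_ : Point → Point → Set
  y ≈ z = act 𝓛 (to-b₀ y) z ∈ B

  -- Any g moving y into B may replace to-b₀ y in the definition of _≈_.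
  ≈⇒∈B : ∀ g {y z} → act 𝓛 g y ∈ B → y ≈ z → act 𝓛 g z ∈ B
  ≈⇒∈B g {y} {z} gy∈B y≈z = subst (_∈ B) (k∘to-b₀ z) (block-stable k b₀∈B kb₀∈B y≈z)
    where
    k = g ++ reverse (to-b₀ y)
    k∘to-b₀ : ∀ u → act 𝓛 k (act 𝓛 (to-b₀ y) u) ≡ act 𝓛 g u
    k∘to-b₀ u = trans (act-++ g _ _) (cong (act 𝓛 g) (act-reverse-inverseˡ (to-b₀ y) u))
    kb₀∈B : act 𝓛 k b₀ ∈ B
    kb₀∈B = subst (λ v → act 𝓛 k v ∈ B) (act-to-b₀ y) (subst (_∈ B) (sym (k∘to-b₀ y)) gy∈B)

  ∈B⇒≈ : ∀ g {y z} → act 𝓛 g y ∈ B → act 𝓛 g z ∈ B → y ≈ z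
  ∈B⇒≈ g {y} {z} gy∈B gz∈B = subst (_∈ B) (k∘g z) (block-stable k gy∈B kgy∈B gz∈B)
    where
    k = to-b₀ y ++ reverse g
    k∘g : ∀ u → act 𝓛 k (act 𝓛 g u) ≡ act 𝓛 (to-b₀ y) u
    k∘g u = trans (act-++ (to-b₀ y) _ _) (cong (act 𝓛 (to-b₀ y)) (act-reverse-inverseˡ g u))
    kgy∈B : act 𝓛 k (act 𝓛 g y) ∈ B
    kgy∈B = subst (_∈ B) (sym (k∘g y)) (act-to-b₀∈B y)

  ≈-act-cong : ∀ w {y z} → y ≈ z → act 𝓛 w y ≈ act 𝓛 w z
  ≈-act-cong w {y} {z} y≈z = subst (_∈ B) (act-++ h w z) (≈⇒∈B (h ++ w) hwy∈B y≈z)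
    where
    h = to-b₀ (act 𝓛 w y)
    hwy∈B : act 𝓛 (h ++ w) y ∈ B
    hwy∈B = subst (_∈ B) (sym (act-++ h w y)) (act-to-b₀∈B (act 𝓛 w y))

  congruence : Congruence 𝓛
  congruence = record
    { _≈_     = _≈_
    ; _≈?_    = λ y z → act 𝓛 (to-b₀ y) z ∈? B
    ; ≈-refl  = act-to-b₀∈B _
    ; ≈-sym   = λ {y} {z} y≈z → ∈B⇒≈ (to-b₀ y) y≈z (act-to-b₀∈B y)
    ; ≈-trans = λ {y} y≈z z≈u → ≈⇒∈B (to-b₀ y) y≈z z≈u
    ; ≈-cong  = ≈-act-cong
    }

  class-nontrivial : ∀ {b₁} → b₁ ∈ B → b₁ ≢ b₀ → ∀ y → ∃ λ z → z ≢ y × y ≈ z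
  class-nontrivial {b₁} b₁∈B b₁≢b₀ y = z , z≢y , subst (_∈ B) (sym (act-reverse-inverseʳ (to-b₀ y) b₁)) b₁∈B
    where
    z = act 𝓛 (reverse (to-b₀ y)) b₁
    z≢y : z ≢ y
    z≢y z≡y = b₁≢b₀ (trans (sym (act-reverse-inverseʳ (to-b₀ y) b₁))
                           (trans (cong (act 𝓛 (to-b₀ y)) z≡y) (act-to-b₀ y)))

  class-proper : ∀ {b} → b ∉ B → ∀ y → ∃ λ z → ¬ y ≈ z
  class-proper {b} b∉B y = act 𝓛 (reverse (to-b₀ y)) b , b∉B ∘ subst (_∈ B) (act-reverse-inverseʳ (to-b₀ y) b)

module Letters {n} (𝓛 : Family n) (transitive : Transitive 𝓛) (C : Congruence 𝓛) where
  open Toggles 𝓛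
  open Congruence C

  Witness : Fin n → Point → Set
  Witness e y = τ e y ≢ y × τ e y ≈ y

  Internal : Pred (Fin n) _
  Internal e = ∃ (Witness e)

  External : Pred (Fin n) _
  External e = ¬ Internal e

  Internal? : Decidable Internal
  Internal? e = any? λ y → ¬? (τ e y Fin.≟ y) ×-dec (τ e y ≈? y)

  External? : Decidable External
  External? = ¬? ∘ Internal?

  ≡⇒≈ : ∀ {y z} → y ≡ z → y ≈ z
  ≡⇒≈ refl = ≈-refl

  external-moved-≈ : ∀ {f} → External f → ∀ {y z} → y ≈ z → τ f y ≢ y → τ f z ≢ z
  external-moved-≈ {f} f-external {y} y≈z y-moved z-fixed =
    f-external (y , y-moved , ≈-trans (≈-cong [ f ] y≈z) (subst (_≈ y) (sym z-fixed) (≈-sym y≈z)))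

  external-fixed-≈ : ∀ {f} → External f → ∀ {y z} → y ≈ z → τ f y ≡ y → τ f z ≡ z
  external-fixed-≈ {f} f-external {z = z} y≈z y-fixed with τ f z Fin.≟ z
  ... | yes z-fixed = z-fixed
  ... | no  z-moved = ⊥-elim (external-moved-≈ f-external (≈-sym y≈z) z-moved y-fixed)

  -- A toggle f either keeps the class of the current point, or moves every point
  -- of that class out of it; in the second case toggle-square carries a witness
  -- for e along f.
  witness-near : ∀ {e y₀} → Witness e y₀ → ∀ g → ∃ λ y → y ≈ act 𝓛 g y₀ × Witness e y
  witness-near w₀ [] = _ , ≈-refl , w₀
  witness-near {e} {y₀} w₀ (f ∷ g) with witness-near w₀ g | act 𝓛 g y₀ ≈? τ f (act 𝓛 g y₀)
  ... | y , y≈u , w                | yes u≈fu = y , ≈-trans y≈u u≈fu , w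
  ... | y , y≈u , (e-moves , ey≈y) | no  u≉fu = τ f y , ≈-cong [ f ] y≈u , e-moves′ , ey′≈y′
    where
    f-moves-near : ∀ {v} → v ≈ act 𝓛 g y₀ → τ f v ≢ v
    f-moves-near {v} v≈u fv≡v = u≉fu (≈-trans (≈-sym v≈u) (≈-trans (≡⇒≈ (sym fv≡v)) (≈-cong [ f ] v≈u)))
    square : τ e (τ f y) ≡ τ f (τ e y)
    square = toggle-square e f y e-moves (f-moves-near y≈u) (f-moves-near (≈-trans ey≈y y≈u))
    e-moves′ : τ e (τ f y) ≢ τ f y
    e-moves′ eq = e-moves (toggle-injective f (trans (sym square) eq))
    ey′≈y′ : τ e (τ f y) ≈ τ f y
    ey′≈y′ = subst (_≈ τ f y) (sym square) (≈-cong [ f ] ey≈y)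

  internal⇒≈ : ∀ {e} → Internal e → ∀ z → τ e z ≈ z
  internal⇒≈ {e} (y₀ , w₀) z with transitive y₀ z
  ... | g , refl with witness-near w₀ g
  ... | y , y≈z , _ , ey≈y = ≈-trans (≈-sym (≈-cong [ e ] y≈z)) (≈-trans ey≈y y≈z)

  internal-external-commute : ∀ {e f} → Internal e → External f → ∀ y → τ e (τ f y) ≡ τ f (τ e y)
  internal-external-commute {e} {f} e-int f-ext y with τ f y Fin.≟ y | τ e y Fin.≟ y
  ... | yes f-fixes | _ =
    trans (cong (τ e) f-fixes) (sym (external-fixed-≈ f-ext (≈-sym (internal⇒≈ e-int y)) f-fixes))
  ... | no f-moves | no e-moves =
    toggle-square e f y e-moves f-moves (external-moved-≈ f-ext (≈-sym (internal⇒≈ e-int y)) f-moves)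
  ... | no f-moves | yes e-fixes = trans e-fixes-τf (cong (τ f) (sym e-fixes))
    where
    -- If e moved τ f y, toggle-square at τ f y would make e move y as well.
    e-fixes-τf : τ e (τ f y) ≡ τ f y
    e-fixes-τf with τ e (τ f y) Fin.≟ τ f y
    ... | yes fixed    = fixed
    ... | no  e-moves′ = ⊥-elim (e-moves′ (sym (toggle-injective f (trans (toggle-involutive f y) y≡))))
      where
      y′ = τ f y
      f-moves′ : τ f y′ ≢ y′
      f-moves′ eq = f-moves (sym (trans (sym (toggle-involutive f y)) eq))
      y≡ : y ≡ τ f (τ e y′)
      y≡ = trans (sym e-fixes) (trans (cong (τ e) (sym (toggle-involutive f y)))
             (toggle-square e f y′ e-moves′ f-moves′ (external-moved-≈ f-ext (≈-sym (internal⇒≈ e-int y′)) f-moves′)))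

  toggle-act-commute : ∀ {f} → External f → ∀ u → All Internal u → ∀ y → τ f (act 𝓛 u y) ≡ act 𝓛 u (τ f y)
  toggle-act-commute f-ext []      []              y = refl
  toggle-act-commute f-ext (e ∷ u) (e-int ∷ u-int) y =
    trans (sym (internal-external-commute e-int f-ext _)) (cong (τ e) (toggle-act-commute f-ext u u-int y))

  act-commute : ∀ u → All Internal u → ∀ v → All External v → ∀ y → act 𝓛 v (act 𝓛 u y) ≡ act 𝓛 u (act 𝓛 v y)
  act-commute u u-int []      []              y = refl
  act-commute u u-int (f ∷ v) (f-ext ∷ v-ext) y =
    trans (cong (τ f) (act-commute u u-int v v-ext y)) (toggle-act-commute f-ext u u-int (act 𝓛 v y))

  act-split : ∀ w y → act 𝓛 w y ≡ act 𝓛 (filter Internal? w) (act 𝓛 (filter External? w) y)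
  act-split []      y = refl
  act-split (e ∷ w) y with Internal? e
  ... | yes _     = cong (τ e) (act-split w y)
  ... | no  e-ext = trans (cong (τ e) (act-split w y))
                      (toggle-act-commute e-ext (filter Internal? w) (Allₚ.all-filter Internal? w) _)

  act-internal-≈ : ∀ u → All Internal u → ∀ y → act 𝓛 u y ≈ y
  act-internal-≈ []      []              y = ≈-refl
  act-internal-≈ (e ∷ u) (e-int ∷ u-int) y = ≈-trans (internal⇒≈ e-int _) (act-internal-≈ u u-int y)

  Δ-act-external : ∀ u → All External u → ∀ {y z} → y ≈ z → ∀ k → Δ (act 𝓛 u y) y k ≡ Δ (act 𝓛 u z) z k
  Δ-act-external []      []              {y} {z} _ k = trans (xor-same (bit y k)) (sym (xor-same (bit z k)))
  Δ-act-external (f ∷ u) (f-ext ∷ u-ext) {y} {z} y≈z k with τ f (act 𝓛 u y) Fin.≟ act 𝓛 u y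
  ... | yes fixed = trans (cong (λ v → Δ v y k) fixed) (trans (Δ-act-external u u-ext y≈z k)
                      (cong (λ v → Δ v z k) (sym (external-fixed-≈ f-ext (≈-cong u y≈z) fixed))))
  ... | no  moved = Δ-toggle-moved f k moved (external-moved-≈ f-ext (≈-cong u y≈z) moved) (Δ-act-external u u-ext y≈z k)

module Orbit {n} (𝓛 : Family n) (transitive : Transitive 𝓛) (C : Congruence 𝓛)
             (w : List (Fin n)) (x₀ : Fin (deg 𝓛))
             (distinct : ∀ (i j : Fin (deg 𝓛)) → i ≢ j → iterate (act 𝓛 w) (toℕ i) x₀ ≢ iterate (act 𝓛 w) (toℕ j) x₀)
             (returns : iterate (act 𝓛 w) (deg 𝓛) x₀ ≡ x₀) where
  open Toggles 𝓛
  open Congruence C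
  open Letters 𝓛 transitive C
  open FullCycle (act 𝓛 w) x₀ distinct returns

  N : ℕ
  N = deg 𝓛

  c : Point → Point
  c = act 𝓛 w

  Recurs : ℕ → Set
  Recurs j = x j ≈ x₀

  act-power-x : ∀ i j → act 𝓛 (power w i) (x j) ≡ x (i + j)
  act-power-x i j = trans (act-power w i (x j)) (sym (x-+ i j))

  Recurs-shift : ∀ i {j} → Recurs j → x (i + j) ≈ x i
  Recurs-shift i {j} rec-j =
    subst₂ _≈_ (act-power-x i j) (trans (act-power-x i 0) (cong x (+-identityʳ i))) (≈-cong (power w i) rec-j)

  Recurs-+ : ∀ {i j} → Recurs i → Recurs j → Recurs (i + j)
  Recurs-+ {i} rec-i rec-j = ≈-trans (Recurs-shift i rec-j) rec-i

  Recurs-∸ : ∀ {i j} → Recurs i → Recurs (i + j) → Recurs j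
  Recurs-∸ {i} {j} rec-i rec-i+j =
    subst₂ _≈_ (back j) (trans (cong (act 𝓛 (reverse (power w i)) ∘ x) (sym (+-identityʳ i))) (back 0))
      (≈-cong (reverse (power w i)) (≈-trans rec-i+j (≈-sym rec-i)))
    where
    back : ∀ j → act 𝓛 (reverse (power w i)) (x (i + j)) ≡ x j
    back j = trans (cong (act 𝓛 (reverse (power w i))) (sym (act-power-x i j))) (act-reverse-inverseˡ (power w i) (x j))

  Recurs-* : ∀ {m} → Recurs m → ∀ q → Recurs (q * m)
  Recurs-*     rec-m zero    = ≈-refl
  Recurs-* {m} rec-m (suc q) = Recurs-+ {m} {q * m} rec-m (Recurs-* rec-m q)

  N>0 : N > 0
  N>0 = ≤-<-trans z≤n (toℕ<n x₀)

  Recurs-N : Recurs N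
  Recurs-N = ≡⇒≈ returns

  opaque
    period : ∃[ r ] ((r > 0 × Recurs r) × (∀ k → k < r → ¬ (k > 0 × Recurs k)))
    period = minimal-witness (λ k → (0 ℕ.<? k) ×-dec (x k ≈? x₀)) N (N>0 , Recurs-N)

  r : ℕ
  r = proj₁ period

  instance
    r-nonZero : NonZero r
    r-nonZero = ℕ.>-nonZero (proj₁ (proj₁ (proj₂ period)))

  Recurs-r : Recurs r
  Recurs-r = proj₂ (proj₁ (proj₂ period))

  Recurs⇔∣ : ∀ j → Recurs j ⇔ r ∣ j
  Recurs⇔∣ j = mk⇔ Recurs⇒∣ ∣⇒Recurs
    where
    Recurs⇒∣ : Recurs j → r ∣ j
    Recurs⇒∣ rec-j = m%n≡0⇒n∣m j r (remainder-zero (Recurs-∸ {j / r * r} {j % r} (Recurs-* {r} Recurs-r (j / r))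
      (subst Recurs (trans (m≡m%n+[m/n]*n j r) (+-comm (j % r) (j / r * r))) rec-j)))
      where
      remainder-zero : Recurs (j % r) → j % r ≡ 0
      remainder-zero rec-% with j % r in eq
      ... | zero  = refl
      ... | suc t = ⊥-elim (proj₂ (proj₂ period) (suc t) (subst (_< r) eq (m%n<n j r)) (z<s , rec-%))
    ∣⇒Recurs : r ∣ j → Recurs j
    ∣⇒Recurs (divides q refl) = Recurs-* {r} Recurs-r q

  r∣N : r ∣ N
  r∣N = Equivalence.to (Recurs⇔∣ N) Recurs-N

  r≢N : ∀ {y} → y ≢ x₀ → x₀ ≈ y → r ≢ N
  r≢N {y} y≢x₀ x₀≈y r≡N with orbit-surjective y
  ... | j , refl = <-irrefl refl (≤-<-trans (subst (_≤ toℕ j) r≡N r≤j) (toℕ<n j))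
    where
    instance
      j-nonZero : NonZero (toℕ j)
      j-nonZero = ℕ.≢-nonZero (y≢x₀ ∘ cong x)
    r≤j : r ≤ toℕ j
    r≤j = ∣⇒≤ (Equivalence.to (Recurs⇔∣ (toℕ j)) (≈-sym x₀≈y))

  r≢1 : ∀ {y} → ¬ x₀ ≈ y → r ≢ 1
  r≢1 {y} x₀≉y r≡1 with orbit-surjective y
  ... | j , refl = x₀≉y (≈-sym (Equivalence.from (Recurs⇔∣ (toℕ j)) (subst (_∣ toℕ j) (sym r≡1) (1∣ toℕ j))))

  Wᴵ Wˣ : List (Fin n)
  Wᴵ = filter Internal? w
  Wˣ = filter External? w

  Wᴵ-internal : All Internal Wᴵ
  Wᴵ-internal = Allₚ.all-filter Internal? w

  Wˣ-external : All External Wˣ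
  Wˣ-external = Allₚ.all-filter External? w

  cᴵ cˣ : Point → Point
  cᴵ = act 𝓛 Wᴵ
  cˣ = act 𝓛 Wˣ

  c≡cᴵ∘cˣ : ∀ z → c z ≡ cᴵ (cˣ z)
  c≡cᴵ∘cˣ = act-split w

  cˣ∘cᴵ : ∀ z → cˣ (cᴵ z) ≡ cᴵ (cˣ z)
  cˣ∘cᴵ = act-commute Wᴵ Wᴵ-internal Wˣ Wˣ-external

  cᴵ∘c : ∀ z → cᴵ (c z) ≡ c (cᴵ z)
  cᴵ∘c z = trans (cong cᴵ (c≡cᴵ∘cˣ z)) (trans (cong cᴵ (sym (cˣ∘cᴵ z))) (sym (c≡cᴵ∘cˣ (cᴵ z))))

  cˣ∘c : ∀ z → cˣ (c z) ≡ c (cˣ z)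
  cˣ∘c z = trans (cong cˣ (c≡cᴵ∘cˣ z)) (trans (cˣ∘cᴵ (cˣ z)) (sym (c≡cᴵ∘cˣ (cˣ z))))

  opaque
    cᴵ-rotates : ∃ λ (a : Fin N) → ∀ j → cᴵ (x j) ≡ x (j + toℕ a)
    cᴵ-rotates = commuting⇒rotation cᴵ cᴵ∘c

    cˣ-rotates : ∃ λ (b : Fin N) → ∀ j → cˣ (x j) ≡ x (j + toℕ b)
    cˣ-rotates = commuting⇒rotation cˣ cˣ∘c

  a b : ℕ
  a = toℕ (proj₁ cᴵ-rotates)
  b = toℕ (proj₁ cˣ-rotates)

  cᴵ-rotation : ∀ j → cᴵ (x j) ≡ x (j + a)
  cᴵ-rotation = proj₂ cᴵ-rotates

  cˣ-rotation : ∀ j → cˣ (x j) ≡ x (j + b)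
  cˣ-rotation = proj₂ cˣ-rotates

  r∣a : r ∣ a
  r∣a = Equivalence.to (Recurs⇔∣ a) (subst (_≈ x₀) (cᴵ-rotation 0) (act-internal-≈ Wᴵ Wᴵ-internal x₀))

  Y : ℕ → Point
  Y j = iterate cˣ j x₀

  Y≡x : ∀ j → Y j ≡ x (j * b)
  Y≡x j = iterate-rotation cˣ-rotation j 0

  -- cᴵ rotates the orbit by a multiple of r, so cᴵ^t is the identity once N ∣ t r.
  x≡Y : ∀ t → N ∣ t * r → x t ≡ Y t
  x≡Y t (divides m tr≡mN) = begin
    x t                     ≡⟨ iterate-split t x₀ ⟩
    iterate cᴵ t (Y t)      ≡⟨ cong (iterate cᴵ t) (Y≡x t) ⟩
    iterate cᴵ t (x (t * b)) ≡⟨ iterate-rotation cᴵ-rotation t (t * b) ⟩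
    x (t * b + t * a)       ≡⟨ cong (λ m → x (t * b + m)) ta≡ ⟩
    x (t * b + a′ * m * N)    ≡⟨ x-periodic (a′ * m) (t * b) ⟩
    x (t * b)               ≡⟨ Y≡x t ⟨
    Y t                     ∎
    where
    open ≡-Reasoning
    iterate-split : ∀ m z → iterate c m z ≡ iterate cᴵ m (iterate cˣ m z)
    iterate-split zero    z = refl
    iterate-split (suc m) z = trans (cong c (iterate-split m z))
      (trans (c≡cᴵ∘cˣ _) (cong cᴵ (iterate-commute cᴵ cˣ cˣ∘cᴵ m _)))
    a′ = _∣_.quotient r∣a
    ta≡ : t * a ≡ a′ * m * N
    ta≡ = begin
      t * a        ≡⟨ cong (t *_) (_∣_.equality r∣a) ⟩
      t * (a′ * r) ≡⟨ *-comm t (a′ * r) ⟩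
      a′ * r * t   ≡⟨ *-assoc a′ r t ⟩
      a′ * (r * t) ≡⟨ cong (a′ *_) (trans (*-comm r t) tr≡mN) ⟩
      a′ * (m * N) ≡⟨ *-assoc a′ m N ⟨
      a′ * m * N   ∎

  D : Fin n → Bool
  D = Δ (Y r) x₀

  Y-+ : ∀ i j → Y (i + j) ≡ act 𝓛 (power Wˣ i) (Y j)
  Y-+ i j = trans (iterate-+ cˣ i j x₀) (sym (act-power Wˣ i (Y j)))

  Y-*r-≈ : ∀ q → Y (q * r) ≈ x₀
  Y-*r-≈ q = subst (_≈ x₀) (sym (Y≡x (q * r))) (Equivalence.from (Recurs⇔∣ (q * r * b)) (divides (q * b) (begin
    q * r * b   ≡⟨ *-assoc q r b ⟩
    q * (r * b) ≡⟨ cong (q *_) (*-comm r b) ⟩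
    q * (b * r) ≡⟨ *-assoc q b r ⟨
    q * b * r   ∎)))
    where open ≡-Reasoning

  Δ-Y-*r : ∀ q k → Δ (Y (q * r)) x₀ k ≡ isOdd q ∧ D k
  Δ-Y-*r zero    k = xor-same (bit x₀ k)
  Δ-Y-*r (suc q) k = begin
    Δ (Y (r + q * r)) x₀ k                                 ≡⟨ xor-cancel-middle (bit (Y (r + q * r)) k) (bit (Y (q * r)) k) (bit x₀ k) ⟨
    Δ (Y (r + q * r)) (Y (q * r)) k xor Δ (Y (q * r)) x₀ k ≡⟨ cong₂ _xor_ step (Δ-Y-*r q k) ⟩
    D k xor (isOdd q ∧ D k)                                ≡⟨ xor-∧ (isOdd q) (D k) ⟩
    not (isOdd q) ∧ D k                                    ∎
    where
    open ≡-Reasoning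
    step : Δ (Y (r + q * r)) (Y (q * r)) k ≡ D k
    step = trans (cong (λ v → Δ v (Y (q * r)) k) (Y-+ r (q * r)))
      (trans (Δ-act-external (power Wˣ r) (All-power Wˣ-external r) (Y-*r-≈ q) k)
             (cong (λ v → Δ v x₀ k) (sym (trans (cong Y (sym (+-identityʳ r))) (Y-+ r 0)))))

  Y-N : Y N ≡ x₀
  Y-N = trans (Y≡x N) (trans (cong x (*-comm N b)) (x-periodic b 0))

  isOdd∧D≡false : ∀ q → q * r ≡ N → ∀ k → isOdd q ∧ D k ≡ false
  isOdd∧D≡false q qr≡N k =
    trans (sym (Δ-Y-*r q k)) (trans (cong (λ v → Δ v x₀ k) (trans (cong Y qr≡N) Y-N)) (xor-same (bit x₀ k)))

  module TwoPointClasses (s : Fin n) (D-s : D s ≡ true) (N≡r+r : N ≡ r + r) (x-r≡Y-r : x r ≡ Y r) where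

    Δ-x-r : ∀ k → Δ (x r) x₀ k ≡ D k
    Δ-x-r k = cong (λ v → Δ v x₀ k) x-r≡Y-r

    Δ-untouched : ∀ u → All (_≢ s) u → Δ (act 𝓛 u x₀) x₀ s ≡ false
    Δ-untouched u u≢s = trans (cong (_xor bit x₀ s) (bit-act-untouched u u≢s x₀)) (xor-same (bit x₀ s))

    s-external : External s
    s-external s-internal = true≢false (trans (sym D-s) (trans (cong (λ v → Δ v x₀ s) Y-r) (Δ-untouched _ ≢s)))
      where
      Y-r : Y r ≡ act 𝓛 (power Wˣ r) x₀
      Y-r = trans (cong Y (sym (+-identityʳ r))) (Y-+ r 0)
      ≢s : All (_≢ s) (power Wˣ r)
      ≢s = All.map (λ f-ext f≡s → f-ext (subst Internal (sym f≡s) s-internal)) (All-power Wˣ-external r)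

    a≡0 : a ≡ 0
    a≡0 with r∣a
    ... | divides zero          a≡0   = a≡0
    ... | divides (suc zero)    a≡r+0 = ⊥-elim (true≢false (begin
      true                       ≡⟨ trans (sym D-s) (sym (Δ-x-r s)) ⟩
      Δ (x r) x₀ s               ≡⟨ cong (λ v → Δ v x₀ s) (trans (cong x (sym (trans a≡r+0 (+-identityʳ r)))) (sym (cᴵ-rotation 0))) ⟩
      Δ (cᴵ x₀) x₀ s             ≡⟨ Δ-untouched Wᴵ (All.map (λ e-int e≡s → s-external (subst Internal e≡s e-int)) Wᴵ-internal) ⟩
      false                      ∎))
      where open ≡-Reasoning
    ... | divides (suc (suc m)) a≡   = ⊥-elim (<-irrefl refl (≤-trans (toℕ<n (proj₁ cᴵ-rotates))
      (subst (N ≤_) (sym a≡) (subst (_≤ r + (r + m * r)) (sym N≡r+r) (+-monoʳ-≤ r (m≤m+n r (m * r)))))))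

    c≡cˣ : ∀ z → c z ≡ cˣ z
    c≡cˣ z with orbit-surjective z
    ... | j , refl = begin
      c (x (toℕ j))           ≡⟨ c≡cᴵ∘cˣ _ ⟩
      cᴵ (cˣ (x (toℕ j)))     ≡⟨ cong cᴵ (cˣ-rotation (toℕ j)) ⟩
      cᴵ (x (toℕ j + b))      ≡⟨ cᴵ-rotation (toℕ j + b) ⟩
      x (toℕ j + b + a)       ≡⟨ cong x (trans (cong (toℕ j + b +_) a≡0) (+-identityʳ _)) ⟩
      x (toℕ j + b)           ≡⟨ cˣ-rotation (toℕ j) ⟨
      cˣ (x (toℕ j))          ∎
      where open ≡-Reasoning

    σ : Point → Point
    σ = act 𝓛 (power w r)

    σ-x : ∀ j → σ (x j) ≡ x (j + r)
    σ-x j = trans (act-power-x r j) (cong x (+-comm r j))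

    σ-≈ : ∀ z → σ z ≈ z
    σ-≈ z with orbit-surjective z
    ... | j , refl = subst (_≈ x (toℕ j)) (sym (σ-x (toℕ j))) (Recurs-shift (toℕ j) Recurs-r)

    σ-involutive : ∀ z → σ (σ z) ≡ z
    σ-involutive z with orbit-surjective z
    ... | j , refl = trans (cong σ (σ-x (toℕ j))) (trans (σ-x (toℕ j + r))
      (trans (cong x (trans (+-assoc (toℕ j) r r) (cong (toℕ j +_) (sym N≡r+r)))) (x-+N (toℕ j))))

    Δ-σ : ∀ z k → Δ (σ z) z k ≡ D k
    Δ-σ z k with orbit-surjective z
    ... | j′ , refl = begin
      Δ (σ (x j)) (x j) k              ≡⟨ cong₂ (λ u v → Δ u v k) (trans (σ-x j) (x-from r)) (trans (cong x (sym (+-identityʳ j))) (x-from 0)) ⟩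
      Δ (act 𝓛 P (x r)) (act 𝓛 P (x 0)) k ≡⟨ xor-swap-middle (bit (act 𝓛 P (x r)) k) (bit (x r) k) (bit (act 𝓛 P x₀) k) (bit x₀ k)
                                            (Δ-act-external P (All-power Wˣ-external j) Recurs-r k) ⟩
      Δ (x r) x₀ k                     ≡⟨ Δ-x-r k ⟩
      D k                              ∎
      where
      open ≡-Reasoning
      j = toℕ j′
      P = power Wˣ j
      x-from : ∀ i → x (j + i) ≡ act 𝓛 P (x i)
      x-from i = trans (x-+ j i) (trans (iterate-cong c≡cˣ j (x i)) (sym (act-power Wˣ j (x i))))

    σ-τ : ∀ z → σ (τ s z) ≡ τ s (σ z)
    σ-τ z with τ s z Fin.≟ z
    ... | yes fixed = trans (cong σ fixed) (sym (external-fixed-≈ s-external (≈-sym (σ-≈ z)) fixed))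
    ... | no  moved = ≡-from-bits λ k → xor-cancelʳ _ _ (bit (σ z) k) (begin
      Δ (σ (τ s z)) (σ z) k ≡⟨ xor-swap-middle (bit (σ (τ s z)) k) (bit (τ s z) k) (bit (σ z) k) (bit z k)
                                  (trans (Δ-σ (τ s z) k) (sym (Δ-σ z k))) ⟩
      Δ (τ s z) z k         ≡⟨ Δ-toggle-moved s k moved′ moved (trans (xor-same (bit (σ z) k)) (sym (xor-same (bit z k)))) ⟨
      Δ (τ s (σ z)) (σ z) k ∎)
      where
      open ≡-Reasoning
      moved′ : τ s (σ z) ≢ σ z
      moved′ = external-moved-≈ s-external (≈-sym (σ-≈ z)) moved

    moves : Point → ℕ
    moves z with τ s z Fin.≟ z
    ... | yes _ = 0
    ... | no  _ = 1

    moves-fixed : ∀ {z} → τ s z ≡ z → moves z ≡ 0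
    moves-fixed {z} fixed with τ s z Fin.≟ z
    ... | yes _     = refl
    ... | no  moved = ⊥-elim (moved fixed)

    moves-moved : ∀ {z} → τ s z ≢ z → moves z ≡ 1
    moves-moved {z} moved with τ s z Fin.≟ z
    ... | yes fixed = ⊥-elim (moved fixed)
    ... | no  _     = refl

    moves-≈ : ∀ {y z} → y ≈ z → moves y ≡ moves z
    moves-≈ {y} y≈z with τ s y Fin.≟ y
    ... | yes fixed = sym (moves-fixed (external-fixed-≈ s-external y≈z fixed))
    ... | no  moved = sym (moves-moved (external-moved-≈ s-external y≈z moved))

    moves-τ : ∀ z → moves (τ s z) ≡ moves z
    moves-τ z with τ s z Fin.≟ z
    ... | yes fixed = trans (cong moves fixed) (moves-fixed fixed)
    ... | no  moved = moves-moved moved′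
      where
      moved′ : τ s (τ s z) ≢ τ s z
      moved′ eq = moved (sym (trans (sym (toggle-involutive s z)) eq))

    isOdd-moves : ∀ z → isOdd (moves z) ≡ bit z s xor bit (τ s z) s
    isOdd-moves z with τ s z Fin.≟ z
    ... | yes fixed = sym (trans (cong (λ v → bit z s xor bit v s) fixed) (xor-same (bit z s)))
    ... | no  moved = sym (trans (cong (bit z s xor_) (bit-toggle s z moved)) (xor-inverseʳ (bit z s)))

    ρ : Point → Point
    ρ z = τ s (σ z)

    ρ-involutive : ∀ z → ρ (ρ z) ≡ z
    ρ-involutive z = trans (cong (τ s) (σ-τ (σ z))) (trans (toggle-involutive s (σ (σ z))) (σ-involutive z))

    moves₀ moves₁ : Point → ℕ
    moves₀ z = if bit z s then 0 else moves z
    moves₁ z = if bit z s then moves z else 0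

    moves≡moves₀+moves₁ : ∀ z → moves z ≡ moves₀ z + moves₁ z
    moves≡moves₀+moves₁ z with bit z s
    ... | true  = refl
    ... | false = sym (+-identityʳ (moves z))

    moves₀-zero : ∀ {z} → moves z ≡ 0 → moves₀ z ≡ 0
    moves₀-zero {z} moves≡0 with bit z s
    ... | true  = refl
    ... | false = moves≡0

    bit-σ : ∀ z → bit (σ z) s ≡ not (bit z s)
    bit-σ z = xor≡true⇒≡not (trans (Δ-σ z s) D-s)

    moves₁∘σ : ∀ z → moves₁ (σ z) ≡ moves₀ z
    moves₁∘σ z rewrite bit-σ z | moves-≈ (σ-≈ z) with bit z s
    ... | true  = refl
    ... | false = refl

    moves₀∘ρ : ∀ z → moves₀ (ρ z) ≡ moves₀ z
    moves₀∘ρ z with τ s (σ z) Fin.≟ σ z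
    ... | yes fixed = trans (moves₀-zero (trans (moves-τ (σ z)) σz-still))
                        (sym (moves₀-zero (trans (sym (moves-≈ (σ-≈ z))) σz-still)))
      where
      σz-still : moves (σ z) ≡ 0
      σz-still = moves-fixed fixed
    ... | no  moved rewrite bit-toggle s (σ z) moved | bit-σ z | not-involutive (bit z s)
                          | moves-τ (σ z) | moves-≈ (σ-≈ z) = refl

    ρ-fixed : ∀ z → ρ z ≡ z → moves₀ z ≡ 0
    ρ-fixed z ρz≡z = moves₀-zero (moves-fixed fixed)
      where
      σz≡τz : σ z ≡ τ s z
      σz≡τz = trans (sym (toggle-involutive s (σ z))) (cong (τ s) ρz≡z)
      fixed : τ s z ≡ z
      fixed with τ s z Fin.≟ z
      ... | yes fixed = fixed
      ... | no  moved = ⊥-elim (s-external (z , moved , subst (_≈ z) σz≡τz (σ-≈ z)))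

    -- ⟨σ, τ s⟩ acts freely on the points moved by τ s, so they come in fours.
    4∣∑moves : 4 ∣ sum moves
    4∣∑moves = divides t (begin
      sum moves                       ≡⟨ sum-cong-≗ moves≡moves₀+moves₁ ⟩
      sum (λ z → moves₀ z + moves₁ z) ≡⟨ ∑-distrib-+ moves₀ moves₁ ⟩
      sum moves₀ + sum moves₁         ≡⟨ cong (sum moves₀ +_) ∑moves₁≡∑moves₀ ⟩
      sum moves₀ + sum moves₀         ≡⟨ cong (λ m → m + m) (_∣_.equality ∑moves₀-even) ⟩
      t * 2 + t * 2                   ≡⟨ *-distribˡ-+ t 2 2 ⟨
      t * 4                           ∎)
      where
      open ≡-Reasoning
      ∑moves₀-even : 2 ∣ sum moves₀
      ∑moves₀-even = sum-involution-invariant-even ρ ρ-involutive moves₀ moves₀∘ρ ρ-fixed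
      t : ℕ
      t = _∣_.quotient ∑moves₀-even
      ∑moves₁≡∑moves₀ : sum moves₁ ≡ sum moves₀
      ∑moves₁≡∑moves₀ = trans (sym (sum-∘-bijection σ σ σ-involutive σ-involutive moves₁)) (sum-cong-≗ moves₁∘σ)

    s-count : Fin n → Point → ℕ
    s-count f y = if does (f Fin.≟ s) then moves y else 0

    s-moves : List (Fin n) → Point → ℕ
    s-moves []      y = 0
    s-moves (f ∷ g) y = s-count f (act 𝓛 g y) + s-moves g y

    s-count-≈ : ∀ f {y z} → y ≈ z → s-count f y ≡ s-count f z
    s-count-≈ f y≈z with f Fin.≟ s
    ... | yes _ = moves-≈ y≈z
    ... | no  _ = refl

    isOdd-s-count : ∀ f v → isOdd (s-count f v) ≡ bit v s xor bit (τ f v) s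
    isOdd-s-count f v with f Fin.≟ s
    ... | yes refl = isOdd-moves v
    ... | no  f≢s  = sym (trans (cong (bit v s xor_) (bit-toggle-≢ f v s (f≢s ∘ sym))) (xor-same (bit v s)))

    4∣∑s-count : ∀ f → 4 ∣ sum (s-count f)
    4∣∑s-count f with f Fin.≟ s
    ... | yes _ = 4∣∑moves
    ... | no  _ = divides 0 (sum-replicate-zero N)

    s-moves-≈ : ∀ g {y z} → y ≈ z → s-moves g y ≡ s-moves g z
    s-moves-≈ []      y≈z = refl
    s-moves-≈ (f ∷ g) y≈z = cong₂ _+_ (s-count-≈ f (≈-cong g y≈z)) (s-moves-≈ g y≈z)

    isOdd-s-moves : ∀ g y → isOdd (s-moves g y) ≡ bit y s xor bit (act 𝓛 g y) s
    isOdd-s-moves []      y = sym (xor-same (bit y s))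
    isOdd-s-moves (f ∷ g) y = begin
      isOdd (s-count f v + s-moves g y)                  ≡⟨ isOdd-+ (s-count f v) (s-moves g y) ⟩
      isOdd (s-count f v) xor isOdd (s-moves g y)        ≡⟨ cong₂ _xor_ (isOdd-s-count f v) (isOdd-s-moves g y) ⟩
      (bit v s xor bit (τ f v) s) xor (bit y s xor bit v s) ≡⟨ xor-comm (bit v s xor bit (τ f v) s) _ ⟩
      (bit y s xor bit v s) xor (bit v s xor bit (τ f v) s) ≡⟨ xor-cancel-middle (bit y s) (bit v s) (bit (τ f v) s) ⟩
      bit y s xor bit (τ f v) s                           ∎
      where
      open ≡-Reasoning
      v = act 𝓛 g y

    4∣∑s-moves : ∀ g → 4 ∣ sum (s-moves g)
    4∣∑s-moves []      = divides 0 (sum-replicate-zero N)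
    4∣∑s-moves (f ∷ g) = subst (4 ∣_) (sym ∑≡) (∣m∣n⇒∣m+n (4∣∑s-count f) (4∣∑s-moves g))
      where
      ∑≡ : sum (s-moves (f ∷ g)) ≡ sum (s-count f) + sum (s-moves g)
      ∑≡ = trans (∑-distrib-+ (s-count f ∘ act 𝓛 g) (s-moves g)) (cong (_+ sum (s-moves g))
             (sum-∘-bijection (act 𝓛 g) (act 𝓛 (reverse g)) (act-reverse-inverseˡ g) (act-reverse-inverseʳ g) (s-count f)))

    ∑s-moves≡odd+odd : ∃ λ S → isOdd S ≡ true × sum (s-moves w) ≡ S + S
    ∑s-moves≡odd+odd = S , S-odd , (begin
      sum (s-moves w)                        ≡⟨ sum≡sum-along-orbit (s-moves w) ⟩
      sumBelow N h                           ≡⟨ cong (λ m → sumBelow m h) N≡r+r ⟩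
      sumBelow (r + r) h                     ≡⟨ sumBelow-+ r r h ⟩
      S + sumBelow r (λ j → h (r + j))       ≡⟨ cong (S +_) (sumBelow-cong r second-half) ⟩
      S + S                                  ∎)
      where
      open ≡-Reasoning
      h : ℕ → ℕ
      h = s-moves w ∘ x
      S = sumBelow r h
      second-half : ∀ j → h (r + j) ≡ h j
      second-half j = s-moves-≈ w (subst (_≈ x j) (cong x (+-comm j r)) (Recurs-shift j Recurs-r))
      S-odd : isOdd S ≡ true
      S-odd = begin
        isOdd S                  ≡⟨ isOdd-sumBelow-telescope r h (λ j → bit (x j) s) (λ j → isOdd-s-moves w (x j)) ⟩
        bit x₀ s xor bit (x r) s ≡⟨ xor-comm (bit x₀ s) (bit (x r) s) ⟩
        Δ (x r) x₀ s             ≡⟨ Δ-x-r s ⟩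
        D s                      ≡⟨ D-s ⟩
        true                     ∎

    impossible : ⊥
    impossible with ∑s-moves≡odd+odd
    ... | S , S-odd , ∑≡S+S = isOdd≡true⇒¬4∣n+n S S-odd (subst (4 ∣_) ∑≡S+S (4∣∑s-moves w))

  module PrimePower (p K : ℕ) (p-prime : Prime p) (N≡p^[1+K] : N ≡ p ^ suc K)
                    (class-nontrivial : ∃ λ y → y ≢ x₀ × x₀ ≈ y) (class-proper : ∃ λ y → ¬ x₀ ≈ y) where

    T : ℕ
    T = p ^ K

    instance
      p-nonZero : NonZero p
      p-nonZero = prime⇒nonZero p-prime
      T-nonZero : NonZero T
      T-nonZero = m^n≢0 p K

    opaque
      p∣r×r∣T : (p ∣ r) × (r ∣ T)
      p∣r×r∣T = proper-∣p^[1+k] p-prime K (subst (r ∣_) N≡p^[1+K] r∣N)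
        (r≢1 (proj₂ class-proper))
        (λ r≡p^[1+K] → r≢N (proj₁ (proj₂ class-nontrivial)) (proj₂ (proj₂ class-nontrivial))
                           (trans r≡p^[1+K] (sym N≡p^[1+K])))

    u : ℕ
    u = _∣_.quotient (proj₂ p∣r×r∣T)

    T≡u*r : T ≡ u * r
    T≡u*r = _∣_.equality (proj₂ p∣r×r∣T)

    p*u*r≡N : p * u * r ≡ N
    p*u*r≡N = trans (*-assoc p u r) (trans (cong (p *_) (sym T≡u*r)) (sym N≡p^[1+K]))

    x-T≡Y-T : x T ≡ Y T
    x-T≡Y-T = x≡Y T (divides r′ (begin
      T * r         ≡⟨ cong (T *_) (_∣_.equality (proj₁ p∣r×r∣T)) ⟩
      T * (r′ * p)  ≡⟨ *-comm T (r′ * p) ⟩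
      r′ * p * T    ≡⟨ *-assoc r′ p T ⟩
      r′ * (p * T)  ≡⟨ cong (r′ *_) N≡p^[1+K] ⟨
      r′ * N        ∎))
      where
      open ≡-Reasoning
      r′ = _∣_.quotient (proj₁ p∣r×r∣T)

    Δ-x-T : ∀ k → Δ (x T) x₀ k ≡ isOdd u ∧ D k
    Δ-x-T k = trans (cong (λ v → Δ v x₀ k) (trans x-T≡Y-T (cong Y T≡u*r))) (Δ-Y-*r u k)

    x-T≢x₀ : x T ≢ x₀
    x-T≢x₀ x-T≡x₀ = distinct (fromℕ< T<N) (fromℕ< N>0) T≢0
      (trans (cong x (toℕ-fromℕ< T<N)) (trans x-T≡x₀ (cong x (sym (toℕ-fromℕ< N>0)))))
      where
      T<N : T < N
      T<N = subst (T <_) (trans (*-comm T p) (sym N≡p^[1+K]))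
              (m<m*n T p (nonTrivial⇒n>1 p {{prime⇒nonTrivial p-prime}}))
      T≢0 : fromℕ< T<N ≢ fromℕ< N>0
      T≢0 eq = ℕ.≢-nonZero⁻¹ T (trans (sym (toℕ-fromℕ< T<N)) (trans (cong toℕ eq) (toℕ-fromℕ< N>0)))

    opaque
      translated-letter : ∃ λ s → isOdd u ≡ true × D s ≡ true
      translated-letter with any? (λ k → isOdd u ∧ D k ≟ᴮ true)
      ... | yes (s , u∧Ds) = s , ∧≡true u∧Ds
      ... | no  none = ⊥-elim (x-T≢x₀ (≡-from-bits λ k →
                         xor≡false⇒≡ (trans (Δ-x-T k) (¬-not (λ hit → none (k , hit))))))

    s : Fin n
    s = proj₁ translated-letter

    u-odd : isOdd u ≡ true
    u-odd = proj₁ (proj₂ translated-letter)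

    D-s : D s ≡ true
    D-s = proj₂ (proj₂ translated-letter)

    p-even : isOdd p ≡ false
    p-even = begin
      isOdd p                     ≡⟨ trans (∧-identityʳ (isOdd p ∧ true)) (∧-identityʳ (isOdd p)) ⟨
      (isOdd p ∧ true) ∧ true     ≡⟨ cong₂ (λ a d → (isOdd p ∧ a) ∧ d) u-odd D-s ⟨
      (isOdd p ∧ isOdd u) ∧ D s   ≡⟨ cong (_∧ D s) (isOdd-* p u) ⟨
      isOdd (p * u) ∧ D s         ≡⟨ isOdd∧D≡false (p * u) p*u*r≡N s ⟩
      false                       ∎
      where open ≡-Reasoning

    p≡2 : p ≡ 2
    p≡2 with prime⇒irreducible p-prime (isOdd≡false⇒2∣ p p-even)
    ... | inj₂ 2≡p = sym 2≡p

    u≡1 : u ≡ 1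
    u≡1 with ∣p^k⇒≡p^j p-prime K (divides r (trans T≡u*r (*-comm u r)))
    ... | zero  , _ , u≡1      = u≡1
    ... | suc i , _ , u≡p^[1+i] = ⊥-elim (true≢false (begin
      true                    ≡⟨ u-odd ⟨
      isOdd u                 ≡⟨ cong isOdd u≡p^[1+i] ⟩
      isOdd (p * p ^ i)       ≡⟨ isOdd-* p (p ^ i) ⟩
      isOdd p ∧ isOdd (p ^ i) ≡⟨ cong (λ q → isOdd q ∧ isOdd (p ^ i)) p≡2 ⟩
      false                   ∎))
      where open ≡-Reasoning

    T≡r : T ≡ r
    T≡r = trans T≡u*r (trans (cong (_* r) u≡1) (+-identityʳ r))

    impossible : ⊥
    impossible = TwoPointClasses.impossible s D-s N≡r+r (subst (λ t → x t ≡ Y t) T≡r x-T≡Y-T)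
      where
      N≡r+r : N ≡ r + r
      N≡r+r = trans N≡p^[1+K] (trans (cong₂ _*_ p≡2 T≡r) (cong (r +_) (+-identityʳ r)))

corollary4p4 : (n : ℕ) (𝓛 : Family n) → Transitive 𝓛 → IsPrimePower (deg 𝓛) → ContainsFullCycle 𝓛 → Primitive 𝓛
corollary4p4 n 𝓛 transitive (p , K , p-prime , N≡p^[1+K]) (w , x₀ , distinct , returns) = transitive , no-proper-block
  where
  no-proper-block : ∀ B → IsBlock 𝓛 B → ¬ (1 < ∣ B ∣ × ∣ B ∣ < deg 𝓛)
  no-proper-block B B-block (1<∣B∣ , ∣B∣<N) with two-members B 1<∣B∣ | non-member B ∣B∣<N
  ... | b₀ , b₁ , b₀∈B , b₁∈B , b₀≢b₁ | b , b∉B =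
    Orbit.PrimePower.impossible 𝓛 transitive congruence w x₀ distinct returns p K p-prime N≡p^[1+K]
      (class-nontrivial b₁∈B (b₀≢b₁ ∘ sym) x₀) (class-proper b∉B x₀)
    where open BlockCongruence 𝓛 transitive B B-block b₀∈B
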